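{- Let $\langle\mathbb{S},\to\rangle$ be a total transition system and $M=\mathscr{M}_\to$. Then $\rho^\forall_M$ is complete for $\oplus$, i.e. $\rho^\forall_M(\oplus(X))=\rho^\forall_M(\oplus(\rho^\forall_M(X)))$ for all $X\subseteq\mathbb{T}$, if and only if $\to$ is injective, i.e. for all $r,s,t\in\mathbb{S}$, $r\to t$ and $s\to t$ imply $r=s$.
   Context: $\mathbb{T}$ is the set of traces $\langle i,\sigma\rangle$, $i\in\mathbb{Z}$, $\sigma:\mathbb{Z}\to\mathbb{S}$; $X_{\downarrow s}=\{\langle i,\sigma\rangle\in X\mid\sigma_i=s\}$; $\oplus(X)=\{\langle i,\sigma\rangle\mid\langle i+1,\sigma\rangle\in X\}$. A total transition system $\langle\mathbb{S},\to\rangle$ has every state with a successor and a predecessor; $\mathscr{M}_\to=\{\langle i,\sigma\rangle\mid\forall k\in\mathbb{Z}.\ \sigma_k\to\sigma_{k+1}\}$. $\rho^\forall_M(X)=\{\langle i,\sigma\rangle\in M\mid M_{\downarrow\sigma_i}\subseteq X\}$. -}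

module Defs where

open import Data.Integer using (ℤ; _+_; 1ℤ)
open import Data.Product using (Σ; ∃; _×_; _,_)
open import Relation.Binary.PropositionalEquality using (_≡_)

Trace : Set → Set
Trace S = ℤ × (ℤ → S)

TSet : Set → Set₁
TSet S = Trace S → Set

module _ {S : Set} where

  infix 4 _⊆_ _≐_

  _⊆_ : TSet S → TSet S → Set
  X ⊆ Y = ∀ t → X t → Y t

  _≐_ : TSet S → TSet S → Set
  X ≐ Y = (X ⊆ Y) × (Y ⊆ X)

  _↓_ : TSet S → S → TSet S
  (X ↓ s) (i , σ) = X (i , σ) × (σ i ≡ s)

  ⊕ : TSet S → TSet S
  ⊕ X (i , σ) = X (i + 1ℤ , σ)

  ρ∀ : TSet S → TSet S → TSet S
  ρ∀ M X (i , σ) = M (i , σ) × (M ↓ σ i ⊆ X)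

Total : {S : Set} → (S → S → Set) → Set
Total {S} _⇒_ = (∀ s → ∃ λ t → s ⇒ t) × (∀ s → ∃ λ r → r ⇒ s)

𝓜 : {S : Set} → (S → S → Set) → TSet S
𝓜 _⇒_ (i , σ) = ∀ k → σ k ⇒ σ (k + 1ℤ)

CompleteFor⊕ : {S : Set} → TSet S → Set₁
CompleteFor⊕ {S} M = (X : TSet S) → ρ∀ M (⊕ X) ≐ ρ∀ M (⊕ (ρ∀ M X))

InjectiveRel : {S : Set} → (S → S → Set) → Set
InjectiveRel {S} _⇒_ = ∀ (r s t : S) → r ⇒ t → s ⇒ t → r ≡ s

{-# OPTIONS --safe #-}
-- Since ρ^∀_M(X) only depends on the current state, ⊕ followed by ρ^∀_M asks
-- what all traces currently at the successor state do.  If → is injective, a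
-- trace currently at t = σ_{i+1} was at σ_i one step before, which gives the
-- nontrivial inclusion.  Conversely, take X = "the previous state is r", so that
-- ⊕(X) = "the current state is r", and a trace through r → t lies in ρ^∀_M(⊕(X)).
-- Completeness then puts it into ρ^∀_M(⊕(ρ^∀_M(X))): every trace currently at t
-- was at r one step before, in particular one through s → t, hence s = r.
module Submission where

open import Defs
open import Data.Integer using (ℤ; +_; -[1+_]; _+_; _-_; 0ℤ; 1ℤ)
open import Data.Integer.Properties using (+-0-abelianGroup)
open import Algebra.Properties.AbelianGroup +-0-abelianGroup using (//-rightDividesˡ; //-rightDividesʳ)
open import Data.Nat using (ℕ; zero; suc)
import Data.Nat.Properties as ℕ
open import Data.Product using (Σ-syntax; _×_; _,_; proj₁; proj₂)
open import Function.Bundles using (_⇔_; mk⇔)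
open import Relation.Binary.PropositionalEquality
  using (_≡_; refl; sym; trans; cong; subst)

module _ {S : Set} where

  ρ∀-reductive : (M X : TSet S) → ρ∀ M X ⊆ X
  ρ∀-reductive M X (i , σ) (σ∈M , M↓⊆X) = M↓⊆X (i , σ) (σ∈M , refl)

  ρ∀-mono : (M : TSet S) {X Y : TSet S} → X ⊆ Y → ρ∀ M X ⊆ ρ∀ M Y
  ρ∀-mono M X⊆Y (i , σ) (σ∈M , M↓⊆X) = σ∈M , λ u u∈M↓ → X⊆Y u (M↓⊆X u u∈M↓)

  ⊕-mono : {X Y : TSet S} → X ⊆ Y → ⊕ X ⊆ ⊕ Y
  ⊕-mono X⊆Y (i , σ) = X⊆Y (i + 1ℤ , σ)

  ρ∀-⊕-ρ∀⊆ρ∀-⊕ : (M X : TSet S) → ρ∀ M (⊕ (ρ∀ M X)) ⊆ ρ∀ M (⊕ X)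
  ρ∀-⊕-ρ∀⊆ρ∀-⊕ M X = ρ∀-mono M (⊕-mono (ρ∀-reductive M X))

  ⊕-at-pred : (X : TSet S) {l : ℤ} {σ : ℤ → S} → ⊕ X (l - 1ℤ , σ) → X (l , σ)
  ⊕-at-pred X {l} {σ} = subst (λ k → X (k , σ)) (//-rightDividesˡ 1ℤ l)

module _ {S : Set} {_⇒_ : S → S → Set} where

  edge-on-trace : Total _⇒_ → ∀ {r t} → r ⇒ t →
                  Σ[ σ ∈ (ℤ → S) ] 𝓜 _⇒_ (0ℤ , σ) × σ 0ℤ ≡ r × σ 1ℤ ≡ t
  edge-on-trace (successor , predecessor) {r} {t} r⇒t = σ , step , refl , refl
    where
    forward : ℕ → S
    forward zero    = t
    forward (suc n) = proj₁ (successor (forward n))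

    backward : ℕ → S
    backward zero    = proj₁ (predecessor r)
    backward (suc n) = proj₁ (predecessor (backward n))

    σ : ℤ → S
    σ (+ zero)  = r
    σ (+ suc n) = forward n
    σ -[1+ n ]  = backward n

    step : ∀ k → σ k ⇒ σ (k + 1ℤ)
    step (+ zero)      = r⇒t
    step (+ suc n)     = subst (λ m → forward n ⇒ forward m) (ℕ.+-comm 1 n)
                               (proj₂ (successor (forward n)))
    step -[1+ zero ]   = proj₂ (predecessor r)
    step -[1+ suc n ]  = proj₂ (predecessor (backward n))

  step-into : ∀ {l υ} → 𝓜 _⇒_ (l , υ) → υ (l - 1ℤ) ⇒ υ l
  step-into {l} {υ} υ∈M =
    subst (λ k → υ (l - 1ℤ) ⇒ υ k) (//-rightDividesˡ 1ℤ l) (υ∈M (l - 1ℤ))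

  injective⇒pred-agrees : InjectiveRel _⇒_ → ∀ {j τ l υ} →
                          𝓜 _⇒_ (j , τ) → 𝓜 _⇒_ (l , υ) →
                          υ l ≡ τ (j + 1ℤ) → υ (l - 1ℤ) ≡ τ j
  injective⇒pred-agrees inj {j} {τ} τ∈M υ∈M υl≡τ[j+1] =
    inj _ _ _ (step-into υ∈M) (subst (τ j ⇒_) (sym υl≡τ[j+1]) (τ∈M j))

  injective⇒complete : InjectiveRel _⇒_ → CompleteFor⊕ (𝓜 _⇒_)
  injective⇒complete inj X = ρ∀-⊕⊆ρ∀-⊕-ρ∀ , ρ∀-⊕-ρ∀⊆ρ∀-⊕ M X
    where
    M : TSet S
    M = 𝓜 _⇒_

    ρ∀-⊕⊆ρ∀-⊕-ρ∀ : ρ∀ M (⊕ X) ⊆ ρ∀ M (⊕ (ρ∀ M X))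
    ρ∀-⊕⊆ρ∀-⊕-ρ∀ (i , σ) (σ∈M , M↓σi⊆⊕X) = σ∈M , λ
      { (j , τ) (τ∈M , τj≡σi) → τ∈M , λ
        { (l , υ) (υ∈M , υl≡τ[j+1]) → ⊕-at-pred X (M↓σi⊆⊕X (l - 1ℤ , υ)
            (υ∈M , trans (injective⇒pred-agrees inj τ∈M υ∈M υl≡τ[j+1]) τj≡σi)) } }

  complete⇒pred-agrees : CompleteFor⊕ (𝓜 _⇒_) → ∀ {i σ j τ} →
                         𝓜 _⇒_ (i , σ) → 𝓜 _⇒_ (j , τ) →
                         τ (j + 1ℤ) ≡ σ (i + 1ℤ) → τ j ≡ σ i
  complete⇒pred-agrees complete {i} {σ} {j} {τ} σ∈M τ∈M τ[j+1]≡σ[i+1] =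
    trans (cong τ (sym (//-rightDividesʳ 1ℤ j))) τ[j+1]∈X
    where
    M : TSet S
    M = 𝓜 _⇒_

    X : TSet S
    X (l , υ) = υ (l - 1ℤ) ≡ σ i

    σ∈ρ∀⊕X : ρ∀ M (⊕ X) (i , σ)
    σ∈ρ∀⊕X = σ∈M , λ { (l , υ) (_ , υl≡σi) →
      trans (cong υ (//-rightDividesʳ 1ℤ l)) υl≡σi }

    σ[i+1]∈ρ∀X : ρ∀ M X (i + 1ℤ , σ)
    σ[i+1]∈ρ∀X = ρ∀-reductive M (⊕ (ρ∀ M X)) (i , σ) (proj₁ (complete X) (i , σ) σ∈ρ∀⊕X)

    τ[j+1]∈X : X (j + 1ℤ , τ)
    τ[j+1]∈X = proj₂ σ[i+1]∈ρ∀X (j + 1ℤ , τ) (τ∈M , τ[j+1]≡σ[i+1])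

  complete⇒injective : Total _⇒_ → CompleteFor⊕ (𝓜 _⇒_) → InjectiveRel _⇒_
  complete⇒injective total complete r s t r⇒t s⇒t
    with edge-on-trace total r⇒t | edge-on-trace total s⇒t
  ... | σ , σ∈M , refl , σ1≡t | τ , τ∈M , refl , τ1≡t =
    sym (complete⇒pred-agrees complete σ∈M τ∈M (trans τ1≡t (sym σ1≡t)))

theorem8 : (S : Set) (_⇒_ : S → S → Set) → Total _⇒_ →
    CompleteFor⊕ (𝓜 _⇒_) ⇔ InjectiveRel _⇒_
theorem8 S _⇒_ total = mk⇔ (complete⇒injective total) injective⇒complete
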